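{- Let $n,m,k$ be nonnegative integers with $1\leq k\leq n$, and let $\boldsymbol{\sigma}_{n,m}$ be a permutation chosen uniformly at random from the set of permutations of $[n]$ with exactly $m$ inversions (assumed nonempty). Then for any permutation $\tau$ of length $k$ and any positive integers $i,j\leq n+1-k$, \[\mathbb{P}\big(\text{$\tau$ occurs at position $i$ in $\boldsymbol{\sigma}_{n,m}$}\big)=\mathbb{P}\big(\text{$\tau$ occurs at position $j$ in $\boldsymbol{\sigma}_{n,m}$}\big).\]
   Context: A permutation of length $n$ is a linear ordering $\sigma(1)\ldots\sigma(n)$ of $[n]$; an inversion is a pair $i<j$ with $\sigma(i)>\sigma(j)$. A pattern $\tau$ of length $k$ occurs at position $j$ in $\sigma$ if $\sigma(j)\ldots\sigma(j+k-1)$ has its entries in the same relative order as $\tau(1)\ldots\tau(k)$. -}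

module Defs where

open import Data.Nat using (ℕ; zero; suc; _+_; _∸_; _<ᵇ_; _≡ᵇ_; NonZero)
open import Data.Fin using (Fin; toℕ) renaming (_≟_ to _≟ᶠ_)
open import Data.Bool using (Bool; true; false; _∧_; _∨_; not; _xor_)
open import Data.List using (List; []; _∷_; [_]; map; concatMap; allFin; filterᵇ; length; cartesianProduct)
open import Data.Bool.ListAction using (and)

open import Data.Vec using (Vec; lookup; toList) renaming (_∷_ to _∷ᵥ_; [] to []ᵥ; map to mapᵥ)
open import Data.Product using (_×_; _,_)
open import Data.Integer using (+_)
open import Data.Rational using (ℚ; _/_)
open import Relation.Nullary.Decidable using (⌊_⌋)

allᵇ : {A : Set} → (A → Bool) → List A → Bool
allᵇ p xs = and (map p xs)

-- A word of length k over [n] = {0,…,n-1}; a permutation of [n] is a word of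
-- length n over [n] whose entries are pairwise distinct.
allWords : (k n : ℕ) → List (Vec (Fin n) k)
allWords zero    n = [ []ᵥ ]
allWords (suc k) n = concatMap (λ x → map (x ∷ᵥ_) (allWords k n)) (allFin n)

pairs : (k : ℕ) → List (Fin k × Fin k)
pairs k = cartesianProduct (allFin k) (allFin k)

distinctᵇ : ∀ {n k} → Vec (Fin n) k → Bool
distinctᵇ {n} {k} v =
  allᵇ (λ { (a , b) → ⌊ a ≟ᶠ b ⌋ ∨ not ⌊ lookup v a ≟ᶠ lookup v b ⌋ }) (pairs k)

inversions : ∀ {n} → Vec (Fin n) n → ℕ
inversions {n} σ =
  length (filterᵇ (λ { (a , b) → (toℕ a <ᵇ toℕ b) ∧ (toℕ (lookup σ b) <ᵇ toℕ (lookup σ a)) }) (pairs n))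

permsWithInv : (n m : ℕ) → List (Vec (Fin n) n)
permsWithInv n m = filterᵇ (λ σ → distinctᵇ σ ∧ (inversions σ ≡ᵇ m)) (allWords n n)

-- entry at 0-indexed position x (default 0 out of range; never used out of range)
nth : List ℕ → ℕ → ℕ
nth []       _       = 0
nth (x ∷ xs) zero    = x
nth (x ∷ xs) (suc i) = nth xs i

val : ∀ {n} → Vec (Fin n) n → ℕ → ℕ
val σ x = nth (toList (mapᵥ toℕ σ)) x

-- τ occurs at (1-indexed) position i in σ: σ(i)…σ(i+k-1) is order-isomorphic to τ
occursAt : ∀ {n k} → Vec (Fin k) k → Vec (Fin n) n → ℕ → Bool
occursAt {n} {k} τ σ i =
  allᵇ (λ { (a , b) → not ((toℕ (lookup τ a) <ᵇ toℕ (lookup τ b))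
                          xor (val σ (i ∸ 1 + toℕ a) <ᵇ val σ (i ∸ 1 + toℕ b))) })
      (pairs k)

prob : (n m : ℕ) → .{{_ : NonZero (length (permsWithInv n m))}} →
       ∀ {k} → Vec (Fin k) k → ℕ → ℚ
prob n m τ i =
  (+ length (filterᵇ (λ σ → occursAt τ σ i) (permsWithInv n m)))
    / length (permsWithInv n m)

module Submission where

-- Reverse-complementing a window of consecutive positions (reversing it and replacing each
-- value by the value of opposite rank within the window) preserves the number of inversions:
-- inversions inside the window correspond bijectively, and a pair with only one position in
-- the window keeps its relative order, because the window keeps its set of positions.
-- Reverse-complementing the window of length k+1 at s and then the window of length k at s+1
-- carries an occurrence of τ at position s to one at position s+1, and the inverse composite
-- carries it back; so the numbers of permutations with m inversions and τ at s or at s+1 agree.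

open import Defs
open import Data.Nat using (ℕ; zero; suc; _+_; _*_; _∸_; _≤_; _<_; _≮_; z≤n; s≤s; s≤s⁻¹; z<s; s<s; s<s⁻¹; _<ᵇ_; _≤ᵇ_; _≡ᵇ_; NonZero; _<?_; _≤?_; _≟_)
open import Data.Nat.Properties
open import Data.Bool using (Bool; true; false; _∧_; _∨_; not; _xor_; T; if_then_else_)
open import Data.Bool.Properties using (∧-zeroʳ; T-∧)
open import Data.Fin using (Fin; toℕ; fromℕ<; punchOut) renaming (_≟_ to _≟ᶠ_)
import Data.Fin.Properties as Finₚ
open import Data.Vec using (Vec; lookup; toList; tabulate) renaming (_∷_ to _∷ᵥ_; map to mapᵥ)
import Data.Vec.Properties as Vecₚ
open import Data.List using (List; []; _∷_; map; length; upTo; applyUpTo; allFin; filterᵇ; cartesianProduct; _++_; concatMap)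
import Data.List.Properties as Listₚ
open import Data.Nat.ListAction using (sum)
open import Data.Nat.ListAction.Properties using (sum-↭; sum-++)
open import Data.List.Membership.Propositional using (_∈_)
open import Data.List.Membership.Propositional.Properties using (∈-map⁺; ∈-map⁻; ∈-upTo⁺; ∈-upTo⁻; ∈-cartesianProduct⁺; ∈-allFin; ∈-filter⁺; ∈-filter⁻; ∈-concatMap⁺)
open import Data.List.Membership.Propositional.Properties.WithK using (unique∧set⇒bag)
open import Data.List.Relation.Binary.BagAndSetEquality using (∼bag⇒↭)
open import Data.List.Relation.Binary.Permutation.Propositional using (_↭_)
open import Data.List.Relation.Binary.Permutation.Propositional.Properties using (↭-length; map⁺)
open import Data.List.Relation.Unary.Unique.Propositional using (Unique)
import Data.List.Relation.Unary.Unique.Propositional.Properties as Uniqueₚ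
open import Data.List.Relation.Unary.AllPairs using ([]; _∷_)
open import Data.List.Relation.Unary.All as All using (All; []; _∷_)
import Data.List.Relation.Unary.All.Properties as Allₚ
open import Data.List.Relation.Unary.Any using (here; there)
open import Data.Product using (_×_; _,_; ∃; proj₁; proj₂; uncurry)
open import Function using (_∘_; _⇔_; mk⇔; Equivalence)
open import Function.Definitions using (Injective)
open import Relation.Nullary using (contradiction; yes; no)
open import Relation.Nullary.Decidable using (dec-true; dec-false; does-⇔; ⌊_⌋; T?)
open import Relation.Binary.Definitions using (tri<; tri≈; tri>)
open import Relation.Binary.PropositionalEquality
import Data.Integer as ℤ
import Data.Rational as ℚ
open import Algebra.Properties.CommutativeSemigroup +-commutativeSemigroup using () renaming (interchange to +-interchange)

⟦_⟧ : Bool → ℕ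
⟦ true  ⟧ = 1
⟦ false ⟧ = 0

⟦∧⟧ : ∀ a b → ⟦ a ∧ b ⟧ ≡ ⟦ a ⟧ * ⟦ b ⟧
⟦∧⟧ true  b = sym (+-identityʳ ⟦ b ⟧)
⟦∧⟧ false b = refl

split-⟦⟧ : ∀ b v → v ≡ ⟦ b ⟧ * v + ⟦ not b ⟧ * v
split-⟦⟧ true  v = sym (trans (+-identityʳ (1 * v)) (*-identityˡ v))
split-⟦⟧ false v = sym (*-identityˡ v)

module _ {m n : ℕ} where

  <ᵇ-true : m < n → (m <ᵇ n) ≡ true
  <ᵇ-true = dec-true (m <? n)

  <ᵇ-false : m ≮ n → (m <ᵇ n) ≡ false
  <ᵇ-false = dec-false (m <? n)

  ≡ᵇ-true : m ≡ n → (m ≡ᵇ n) ≡ true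
  ≡ᵇ-true = dec-true (m ≟ n)

  ≡ᵇ-false : m ≢ n → (m ≡ᵇ n) ≡ false
  ≡ᵇ-false = dec-false (m ≟ n)

<ᵇ-cong : ∀ {m n p q} → (m < n → p < q) → (p < q → m < n) → (m <ᵇ n) ≡ (p <ᵇ q)
<ᵇ-cong {m} {n} {p} {q} to from = does-⇔ (mk⇔ to from) (m <? n) (p <? q)

<ᵇ-true⁻¹ : ∀ {m n} → (m <ᵇ n) ≡ true → m < n
<ᵇ-true⁻¹ {m} {n} eq = <ᵇ⇒< m n (subst T (sym eq) _)

≡ᵇ-true⁻¹ : ∀ {m n} → (m ≡ᵇ n) ≡ true → m ≡ n
≡ᵇ-true⁻¹ {m} {n} eq = ≡ᵇ⇒≡ m n (subst T (sym eq) _)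

InjectiveOn : ℕ → (ℕ → ℕ) → Set
InjectiveOn N f = ∀ x y → x < N → y < N → f x ≡ f y → x ≡ y

∑ : ℕ → (ℕ → ℕ) → ℕ
∑ zero    f = 0
∑ (suc N) f = f 0 + ∑ N (f ∘ suc)

syntax ∑ N (λ x → e) = ∑[ x < N ] e

∑-cong : ∀ N {f g : ℕ → ℕ} → (∀ x → x < N → f x ≡ g x) → ∑ N f ≡ ∑ N g
∑-cong zero    eq = refl
∑-cong (suc N) eq = cong₂ _+_ (eq 0 z<s) (∑-cong N (λ x x<N → eq (suc x) (s≤s x<N)))

∑-zero : ∀ N → ∑[ _ < N ] 0 ≡ 0
∑-zero zero    = refl
∑-zero (suc N) = ∑-zero N

∑-one : ∀ N → ∑[ _ < N ] 1 ≡ N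
∑-one zero    = refl
∑-one (suc N) = cong suc (∑-one N)

∑-distrib-+ : ∀ N (f g : ℕ → ℕ) → ∑[ x < N ] (f x + g x) ≡ ∑ N f + ∑ N g
∑-distrib-+ zero    f g = refl
∑-distrib-+ (suc N) f g =
  trans (cong (f 0 + g 0 +_) (∑-distrib-+ N (f ∘ suc) (g ∘ suc))) (+-interchange (f 0) (g 0) _ _)

∑-distribˡ-* : ∀ N c (f : ℕ → ℕ) → ∑[ x < N ] (c * f x) ≡ c * ∑ N f
∑-distribˡ-* zero    c f = sym (*-zeroʳ c)
∑-distribˡ-* (suc N) c f = trans (cong (c * f 0 +_) (∑-distribˡ-* N c (f ∘ suc))) (sym (*-distribˡ-+ c (f 0) _))

∑-mono-≤ : ∀ N {f g : ℕ → ℕ} → (∀ x → x < N → f x ≤ g x) → ∑ N f ≤ ∑ N g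
∑-mono-≤ zero    le = z≤n
∑-mono-≤ (suc N) le = +-mono-≤ (le 0 z<s) (∑-mono-≤ N (λ x x<N → le (suc x) (s≤s x<N)))

∑-mono-< : ∀ N {f g : ℕ → ℕ} → (∀ x → x < N → f x ≤ g x) → ∀ w → w < N → f w < g w → ∑ N f < ∑ N g
∑-mono-< (suc N) le zero    _         lt = +-mono-<-≤ lt (∑-mono-≤ N (λ x x<N → le (suc x) (s≤s x<N)))
∑-mono-< (suc N) le (suc w) (s≤s w<N) lt =
  +-mono-≤-< (le 0 z<s) (∑-mono-< N (λ x x<N → le (suc x) (s≤s x<N)) w w<N lt)

∑-comm : ∀ N M (f : ℕ → ℕ → ℕ) → ∑[ x < N ] ∑[ y < M ] f x y ≡ ∑[ y < M ] ∑[ x < N ] f x y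
∑-comm zero    M f = sym (∑-zero M)
∑-comm (suc N) M f = trans (cong (∑ M (f 0) +_) (∑-comm N M (f ∘ suc)))
                           (sym (∑-distrib-+ M (f 0) (λ y → ∑[ x < N ] f (suc x) y)))

∑-+ : ∀ N M (f : ℕ → ℕ) → ∑ (N + M) f ≡ ∑ N f + ∑[ x < M ] f (N + x)
∑-+ zero    M f = refl
∑-+ (suc N) M f = trans (cong (f 0 +_) (∑-+ N M (f ∘ suc))) (sym (+-assoc (f 0) _ _))

∑-indicator : ∀ N t → t < N → ∑[ u < N ] ⟦ u ≡ᵇ t ⟧ ≡ 1
∑-indicator (suc N) zero    _         = cong suc (∑-zero N)
∑-indicator (suc N) (suc t) (s≤s t<N) = ∑-indicator N t t<N

module _ {A B : Set} (f : A → B) (g : B → A) where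

  Unique-map⁺ : ∀ {xs} → Unique xs → (∀ {x} → x ∈ xs → g (f x) ≡ x) → Unique (map f xs)
  Unique-map⁺ {[]}     []         gf = []
  Unique-map⁺ {x ∷ xs} (x∉ ∷ xs!) gf = distinct x∉ (gf ∘ there) ∷ Unique-map⁺ xs! (gf ∘ there)
    where
    distinct : ∀ {ys} → All (x ≢_) ys → (∀ {y} → y ∈ ys → g (f y) ≡ y) → All (f x ≢_) (map f ys)
    distinct []           _  = []
    distinct (x≢y ∷ x≢ys) gf′ =
      (λ fx≡fy → x≢y (trans (sym (gf (here refl))) (trans (cong g fx≡fy) (gf′ (here refl)))))
      ∷ distinct x≢ys (gf′ ∘ there)

  module _ {xs : List A} {ys : List B} (xs! : Unique xs) (ys! : Unique ys)
           (f∈ : ∀ {x} → x ∈ xs → f x ∈ ys) (g∈ : ∀ {y} → y ∈ ys → g y ∈ xs)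
           (gf : ∀ {x} → x ∈ xs → g (f x) ≡ x) (fg : ∀ {y} → y ∈ ys → f (g y) ≡ y) where

    bijection⇒↭ : map f xs ↭ ys
    bijection⇒↭ = ∼bag⇒↭ (unique∧set⇒bag (Unique-map⁺ xs! gf) ys! (mk⇔ to from))
      where
      to : ∀ {z} → z ∈ map f xs → z ∈ ys
      to z∈ with x , x∈ , refl ← ∈-map⁻ f z∈ = f∈ x∈
      from : ∀ {z} → z ∈ ys → z ∈ map f xs
      from z∈ = subst (_∈ map f xs) (fg z∈) (∈-map⁺ f (g∈ z∈))

    bijection⇒length≡ : length xs ≡ length ys
    bijection⇒length≡ = trans (sym (Listₚ.length-map f xs)) (↭-length bijection⇒↭)

∑≡sum-upTo : ∀ N (f : ℕ → ℕ) → ∑ N f ≡ sum (map f (upTo N))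
∑≡sum-upTo N f = go N f (λ x → x)
  where
  go : ∀ N (f : ℕ → ℕ) (h : ℕ → ℕ) → ∑ N (f ∘ h) ≡ sum (map f (applyUpTo h N))
  go zero    f h = refl
  go (suc N) f h = cong (f (h 0) +_) (go N f (h ∘ suc))

record InverseOn (N : ℕ) (π ρ : ℕ → ℕ) : Set where
  field
    π-< : ∀ x → x < N → π x < N
    ρ-< : ∀ x → x < N → ρ x < N
    ρ∘π : ∀ x → x < N → ρ (π x) ≡ x
    π∘ρ : ∀ x → x < N → π (ρ x) ≡ x

InverseOn-sym : ∀ {N π ρ} → InverseOn N π ρ → InverseOn N ρ π
InverseOn-sym inv = record { π-< = ρ-< ; ρ-< = π-< ; ρ∘π = π∘ρ ; π∘ρ = ρ∘π }
  where open InverseOn inv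

InjectiveOn-∘ : ∀ {N f π ρ} → InjectiveOn N f → InverseOn N π ρ → InjectiveOn N (f ∘ π)
InjectiveOn-∘ {π = π} {ρ} f-injective inv x y x<N y<N eq = begin
  x          ≡⟨ ρ∘π x x<N ⟨
  ρ (π x)    ≡⟨ cong ρ (f-injective _ _ (π-< x x<N) (π-< y y<N) eq) ⟩
  ρ (π y)    ≡⟨ ρ∘π y y<N ⟩
  y          ∎
  where
  open ≡-Reasoning
  open InverseOn inv

∑-reindex : ∀ {N π ρ} → InverseOn N π ρ → (f : ℕ → ℕ) → ∑[ x < N ] f (π x) ≡ ∑ N f
∑-reindex {N} {π} {ρ} inv f = begin
  ∑[ x < N ] f (π x)            ≡⟨ ∑≡sum-upTo N (f ∘ π) ⟩
  sum (map (f ∘ π) (upTo N))    ≡⟨ cong sum (Listₚ.map-∘ (upTo N)) ⟩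
  sum (map f (map π (upTo N)))  ≡⟨ sum-↭ (map⁺ f π-permutes) ⟩
  sum (map f (upTo N))          ≡⟨ ∑≡sum-upTo N f ⟨
  ∑ N f                         ∎
  where
  open ≡-Reasoning
  open InverseOn inv
  π-permutes : map π (upTo N) ↭ upTo N
  π-permutes = bijection⇒↭ π ρ (Uniqueₚ.upTo⁺ N) (Uniqueₚ.upTo⁺ N)
    (∈-upTo⁺ ∘ π-< _ ∘ ∈-upTo⁻) (∈-upTo⁺ ∘ ρ-< _ ∘ ∈-upTo⁻) (ρ∘π _ ∘ ∈-upTo⁻) (π∘ρ _ ∘ ∈-upTo⁻)

search : (ℕ → Bool) → ℕ → ℕ
search p zero    = 0
search p (suc N) = if p 0 then 0 else suc (search (p ∘ suc) N)

search-correct : ∀ N p {u} → u < N → p u ≡ true → search p N < N × p (search p N) ≡ true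
search-correct (suc N) p {u} u<N pu with p 0 in p0
... | true = z<s , p0
search-correct (suc N) p {zero}  _         pu | false = contradiction (trans (sym pu) p0) λ ()
search-correct (suc N) p {suc u} (s≤s u<N) pu | false =
  let found< , found = search-correct N (p ∘ suc) u<N pu in s≤s found< , found

Fin-injective⇒surjective : ∀ {N} (f : Fin N → Fin N) → Injective _≡_ _≡_ f → ∀ j → ∃ λ a → f a ≡ j
Fin-injective⇒surjective {suc N} f f-inj j with Finₚ.any? (λ a → f a Finₚ.≟ j)
... | yes found    = found
... | no  j∉image = contradiction (Finₚ.injective⇒≤ g-injective) (n≮n N)
  where
  j≢f : ∀ a → j ≢ f a
  j≢f a j≡fa = j∉image (a , sym j≡fa)
  g : Fin (suc N) → Fin N
  g a = punchOut (j≢f a)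
  g-injective : Injective _≡_ _≡_ g
  g-injective {a} {b} ga≡gb = f-inj (Finₚ.punchOut-injective (j≢f a) (j≢f b) ga≡gb)

injectiveOn⇒surjectiveOn : ∀ N (h : ℕ → ℕ) → (∀ x → x < N → h x < N) → InjectiveOn N h →
                           ∀ j → j < N → ∃ λ x → x < N × h x ≡ j
injectiveOn⇒surjectiveOn N h h-< h-inj j j<N =
  preimage (Fin-injective⇒surjective hF hF-injective (fromℕ< j<N))
  where
  open ≡-Reasoning
  hF : Fin N → Fin N
  hF a = fromℕ< (h-< (toℕ a) (Finₚ.toℕ<n a))
  hF-injective : Injective _≡_ _≡_ hF
  hF-injective {a} {b} eq = Finₚ.toℕ-injective (h-inj _ _ (Finₚ.toℕ<n a) (Finₚ.toℕ<n b)
    (trans (sym (Finₚ.toℕ-fromℕ< _)) (trans (cong toℕ eq) (Finₚ.toℕ-fromℕ< _))))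
  preimage : ∃ (λ a → hF a ≡ fromℕ< j<N) → ∃ λ x → x < N × h x ≡ j
  preimage (a , hFa≡j) = toℕ a , Finₚ.toℕ<n a , (begin
    h (toℕ a)          ≡⟨ Finₚ.toℕ-fromℕ< _ ⟨
    toℕ (hF a)         ≡⟨ cong toℕ hFa≡j ⟩
    toℕ (fromℕ< j<N)   ≡⟨ Finₚ.toℕ-fromℕ< j<N ⟩
    j                  ∎)

isInversion : (ℕ → ℕ) → ℕ → ℕ → Bool
isInversion h x y = (x <ᵇ y) ∧ (h y <ᵇ h x)

inversionCount : ℕ → (ℕ → ℕ) → ℕ
inversionCount N h = ∑[ x < N ] ∑[ y < N ] ⟦ isInversion h x y ⟧

inversionCount-cong : ∀ N {g h : ℕ → ℕ} → (∀ x → x < N → g x ≡ h x) → inversionCount N g ≡ inversionCount N h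
inversionCount-cong N eq = ∑-cong N λ x x<N → ∑-cong N λ y y<N →
  cong₂ (λ gy gx → ⟦ (x <ᵇ y) ∧ (gy <ᵇ gx) ⟧) (eq y y<N) (eq x x<N)

reflect : ℕ → ℕ → ℕ
reflect K t = K ∸ suc t

reflect-< : ∀ {K t} → t < K → reflect K t < K
reflect-< {t = t} (s≤s t≤K′) = s≤s (m∸n≤m _ t)

reflect-involutive : ∀ {K t} → t < K → reflect K (reflect K t) ≡ t
reflect-involutive (s≤s t≤K′) = m∸[m∸n]≡n t≤K′

reflect-suc : ∀ {K t} → t < K → reflect (suc K) t ≡ suc (reflect K t)
reflect-suc t<K = +-∸-assoc 1 t<K

reflect-inverseOn : ∀ K → InverseOn K (reflect K) (reflect K)
reflect-inverseOn K = record
  { π-< = λ _ → reflect-< ; ρ-< = λ _ → reflect-< ; ρ∘π = λ _ → reflect-involutive ; π∘ρ = λ _ → reflect-involutive }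

reflect-<ᵇ : ∀ {K x y} → x < K → (reflect K x <ᵇ reflect K y) ≡ (y <ᵇ x)
reflect-<ᵇ {K} x<K = <ᵇ-cong (s<s⁻¹ ∘ ∸-cancelʳ-< {o = K}) (λ y<x → ∸-monoʳ-< (s<s y<x) x<K)

module _ (K : ℕ) (L : ℕ → ℕ) where

  rank corank : ℕ → ℕ
  rank   t = ∑[ u < K ] ⟦ L u <ᵇ L t ⟧
  corank t = ∑[ u < K ] ⟦ L t <ᵇ L u ⟧

  unrank : ℕ → ℕ
  unrank j = search (λ u → rank u ≡ᵇ j) K

  -- L ∘ rcPerm is the reverse-complement of L on [0,K): position t receives the value whose
  -- rank is complementary to the rank of the value at the reflected position K-1-t.
  rcPerm rcPerm⁻¹ : ℕ → ℕ
  rcPerm   t = unrank (reflect K (rank (reflect K t)))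
  rcPerm⁻¹ t = reflect K (unrank (reflect K (rank t)))

  module RankProperties (L-injective : InjectiveOn K L) where

    trichotomy : ∀ u t → u < K → t < K → ⟦ u ≡ᵇ t ⟧ + (⟦ L u <ᵇ L t ⟧ + ⟦ L t <ᵇ L u ⟧) ≡ 1
    trichotomy u t u<K t<K with <-cmp (L u) (L t)
    ... | tri< Lu<Lt _ Lu≯Lt
      rewrite <ᵇ-true Lu<Lt | <ᵇ-false Lu≯Lt | ≡ᵇ-false {u} {t} (λ { refl → <-irrefl refl Lu<Lt }) = refl
    ... | tri> Lu≮Lt _ Lt<Lu
      rewrite <ᵇ-true Lt<Lu | <ᵇ-false Lu≮Lt | ≡ᵇ-false {u} {t} (λ { refl → <-irrefl refl Lt<Lu }) = refl
    ... | tri≈ Lu≮Lt Lu≡Lt Lu≯Lt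
      rewrite <ᵇ-false Lu≮Lt | <ᵇ-false Lu≯Lt | L-injective u t u<K t<K Lu≡Lt | ≡ᵇ-true {t} refl = refl

    suc-rank+corank : ∀ t → t < K → suc (rank t + corank t) ≡ K
    suc-rank+corank t t<K = begin
      suc (rank t + corank t)                   ≡⟨ cong (_+ (rank t + corank t)) (∑-indicator K t t<K) ⟨
      ∑ K δ + (rank t + corank t)               ≡⟨ cong (∑ K δ +_) (∑-distrib-+ K below above) ⟨
      ∑ K δ + ∑[ u < K ] (below u + above u)    ≡⟨ ∑-distrib-+ K δ (λ u → below u + above u) ⟨
      ∑[ u < K ] (δ u + (below u + above u))    ≡⟨ ∑-cong K (λ u u<K → trichotomy u t u<K t<K) ⟩
      ∑[ _ < K ] 1                              ≡⟨ ∑-one K ⟩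
      K                                         ∎
      where
      open ≡-Reasoning
      δ below above : ℕ → ℕ
      δ     u = ⟦ u ≡ᵇ t ⟧
      below u = ⟦ L u <ᵇ L t ⟧
      above u = ⟦ L t <ᵇ L u ⟧

    rank-< : ∀ t → t < K → rank t < K
    rank-< t t<K = subst (rank t <_) (suc-rank+corank t t<K) (s≤s (m≤m+n (rank t) (corank t)))

    corank≡reflect-rank : ∀ t → t < K → corank t ≡ reflect K (rank t)
    corank≡reflect-rank t t<K =
      sym (trans (cong (_∸ suc (rank t)) (sym (suc-rank+corank t t<K))) (m+n∸m≡n (rank t) (corank t)))

    rank-mono-< : ∀ {t t′} → t < K → L t < L t′ → rank t < rank t′
    rank-mono-< {t} {t′} t<K Lt<Lt′ = ∑-mono-< K below-t⇒below-t′ t t<K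
      (subst₂ (λ a b → ⟦ a ⟧ < ⟦ b ⟧) (sym (<ᵇ-false (n≮n (L t)))) (sym (<ᵇ-true Lt<Lt′)) z<s)
      where
      below-t⇒below-t′ : ∀ u → u < K → ⟦ L u <ᵇ L t ⟧ ≤ ⟦ L u <ᵇ L t′ ⟧
      below-t⇒below-t′ u _ with L u <ᵇ L t in Lu<ᵇLt
      ... | false = z≤n
      ... | true rewrite <ᵇ-true (<-trans (<ᵇ-true⁻¹ Lu<ᵇLt) Lt<Lt′) = ≤-refl

    rank-injective : InjectiveOn K rank
    rank-injective t t′ t<K t′<K eq with <-cmp (L t) (L t′)
    ... | tri< Lt<Lt′ _ _ = contradiction eq (<⇒≢ (rank-mono-< t<K Lt<Lt′))
    ... | tri≈ _ Lt≡Lt′ _ = L-injective t t′ t<K t′<K Lt≡Lt′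
    ... | tri> _ _ Lt′<Lt = contradiction (sym eq) (<⇒≢ (rank-mono-< t′<K Lt′<Lt))

    rank-<ᵇ : ∀ {t t′} → t < K → t′ < K → (L t <ᵇ L t′) ≡ (rank t <ᵇ rank t′)
    rank-<ᵇ {t} {t′} t<K t′<K = <ᵇ-cong (rank-mono-< t<K) reflects
      where
      reflects : rank t < rank t′ → L t < L t′
      reflects rt<rt′ with <-cmp (L t) (L t′)
      ... | tri< Lt<Lt′ _ _ = Lt<Lt′
      ... | tri≈ _ Lt≡Lt′ _ = contradiction (cong rank (L-injective t t′ t<K t′<K Lt≡Lt′)) (<⇒≢ rt<rt′)
      ... | tri> _ _ Lt′<Lt = contradiction rt<rt′ (<⇒≯ (rank-mono-< t′<K Lt′<Lt))

    unrank-correct : ∀ j → j < K → unrank j < K × rank (unrank j) ≡ j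
    unrank-correct j j<K =
      let t , t<K , rank-t≡j = injectiveOn⇒surjectiveOn K rank rank-< rank-injective j j<K
          found< , found = search-correct K (λ u → rank u ≡ᵇ j) t<K (≡ᵇ-true rank-t≡j)
      in found< , ≡ᵇ-true⁻¹ found

    unrank-rank : ∀ t → t < K → unrank (rank t) ≡ t
    unrank-rank t t<K with unrank-correct (rank t) (rank-< t t<K)
    ... | unrank< , rank-unrank = rank-injective _ t unrank< t<K rank-unrank

    reflect-rank-reflect-< : ∀ t → t < K → reflect K (rank (reflect K t)) < K
    reflect-rank-reflect-< t t<K = reflect-< (rank-< _ (reflect-< t<K))

    rank-rcPerm : ∀ t → t < K → rank (rcPerm t) ≡ reflect K (rank (reflect K t))
    rank-rcPerm t t<K = proj₂ (unrank-correct _ (reflect-rank-reflect-< t t<K))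

    rcPerm-inverseOn : InverseOn K rcPerm rcPerm⁻¹
    rcPerm-inverseOn = record
      { π-< = λ t t<K → proj₁ (unrank-correct _ (reflect-rank-reflect-< t t<K))
      ; ρ-< = λ t t<K → reflect-< (proj₁ (unrank-correct _ (reflect-< (rank-< t t<K))))
      ; ρ∘π = ρ∘π
      ; π∘ρ = π∘ρ
      }
      where
      open ≡-Reasoning
      ρ∘π : ∀ t → t < K → rcPerm⁻¹ (rcPerm t) ≡ t
      ρ∘π t t<K = begin
        reflect K (unrank (reflect K (rank (rcPerm t))))              ≡⟨ cong (reflect K ∘ unrank ∘ reflect K) (rank-rcPerm t t<K) ⟩
        reflect K (unrank (reflect K (reflect K (rank (reflect K t))))) ≡⟨ cong (reflect K ∘ unrank) (reflect-involutive (rank-< _ (reflect-< t<K))) ⟩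
        reflect K (unrank (rank (reflect K t)))                       ≡⟨ cong (reflect K) (unrank-rank _ (reflect-< t<K)) ⟩
        reflect K (reflect K t)                                       ≡⟨ reflect-involutive t<K ⟩
        t                                                             ∎
      π∘ρ : ∀ t → t < K → rcPerm (rcPerm⁻¹ t) ≡ t
      π∘ρ t t<K = begin
        unrank (reflect K (rank (reflect K (reflect K u))))  ≡⟨ cong (unrank ∘ reflect K ∘ rank) (reflect-involutive u<K) ⟩
        unrank (reflect K (rank u))                          ≡⟨ cong (unrank ∘ reflect K) rank-u ⟩
        unrank (reflect K (reflect K (rank t)))              ≡⟨ cong unrank (reflect-involutive (rank-< t t<K)) ⟩
        unrank (rank t)                                      ≡⟨ unrank-rank t t<K ⟩
        t                                                    ∎
        where
        u : ℕ
        u = unrank (reflect K (rank t))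
        u<K : u < K
        u<K = proj₁ (unrank-correct _ (reflect-< (rank-< t t<K)))
        rank-u : rank u ≡ reflect K (rank t)
        rank-u = proj₂ (unrank-correct _ (reflect-< (rank-< t t<K)))

    rcPerm-<ᵇ : ∀ {a b} → a < K → b < K → (L (rcPerm a) <ᵇ L (rcPerm b)) ≡ (L (reflect K b) <ᵇ L (reflect K a))
    rcPerm-<ᵇ {a} {b} a<K b<K = begin
      (L (rcPerm a) <ᵇ L (rcPerm b))                                       ≡⟨ rank-<ᵇ (π-< a a<K) (π-< b b<K) ⟩
      (rank (rcPerm a) <ᵇ rank (rcPerm b))                                 ≡⟨ cong₂ _<ᵇ_ (rank-rcPerm a a<K) (rank-rcPerm b b<K) ⟩
      (reflect K (rank (reflect K a)) <ᵇ reflect K (rank (reflect K b)))   ≡⟨ reflect-<ᵇ (rank-< _ (reflect-< a<K)) ⟩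
      (rank (reflect K b) <ᵇ rank (reflect K a))                           ≡⟨ rank-<ᵇ (reflect-< b<K) (reflect-< a<K) ⟨
      (L (reflect K b) <ᵇ L (reflect K a))                                 ∎
      where
      open ≡-Reasoning
      open InverseOn rcPerm-inverseOn

    inversionCount-rcPerm : inversionCount K (L ∘ rcPerm) ≡ inversionCount K L
    inversionCount-rcPerm = begin
      inversionCount K (L ∘ rcPerm)                                ≡⟨ ∑-cong K (λ a a<K → ∑-cong K (λ b b<K → reversed a<K b<K)) ⟩
      ∑[ a < K ] ∑[ b < K ] inverted (reflect K a) (reflect K b)   ≡⟨ ∑-cong K (λ a _ → ∑-reindex (reflect-inverseOn K) (inverted (reflect K a))) ⟩
      ∑[ a < K ] ∑[ y < K ] inverted (reflect K a) y               ≡⟨ ∑-reindex (reflect-inverseOn K) (λ x → ∑[ y < K ] inverted x y) ⟩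
      ∑[ x < K ] ∑[ y < K ] inverted x y                           ≡⟨ ∑-comm K K inverted ⟩
      inversionCount K L                                           ∎
      where
      open ≡-Reasoning
      inverted : ℕ → ℕ → ℕ
      inverted x y = ⟦ (y <ᵇ x) ∧ (L x <ᵇ L y) ⟧
      reversed : ∀ {a b} → a < K → b < K →
                 ⟦ (a <ᵇ b) ∧ (L (rcPerm b) <ᵇ L (rcPerm a)) ⟧ ≡ inverted (reflect K a) (reflect K b)
      reversed a<K b<K = cong₂ (λ p q → ⟦ p ∧ q ⟧) (sym (reflect-<ᵇ b<K)) (rcPerm-<ᵇ b<K a<K)

module _ {K : ℕ} {L L′ : ℕ → ℕ} (L-injective : InjectiveOn K L)
         (L′≗L∘rcPerm : ∀ t → t < K → L′ t ≡ L (rcPerm K L t)) where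

  open RankProperties K L L-injective

  rcPerm-injectiveOn : InjectiveOn K L′
  rcPerm-injectiveOn a b a<K b<K L′a≡L′b = InjectiveOn-∘ L-injective rcPerm-inverseOn a b a<K b<K
    (trans (sym (L′≗L∘rcPerm a a<K)) (trans L′a≡L′b (L′≗L∘rcPerm b b<K)))

  rank-rcPerm-sequence : ∀ t → t < K → rank K L′ t ≡ reflect K (rank K L (reflect K t))
  rank-rcPerm-sequence t t<K = begin
    ∑[ u < K ] ⟦ L′ u <ᵇ L′ t ⟧                          ≡⟨ ∑-cong K (λ u u<K → cong₂ (λ p q → ⟦ p <ᵇ q ⟧) (L′≗L∘rcPerm u u<K) (L′≗L∘rcPerm t t<K)) ⟩
    ∑[ u < K ] ⟦ L (rcPerm K L u) <ᵇ L (rcPerm K L t) ⟧  ≡⟨ ∑-cong K (λ u u<K → cong ⟦_⟧ (rcPerm-<ᵇ u<K t<K)) ⟩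
    ∑[ u < K ] ⟦ L (reflect K t) <ᵇ L (reflect K u) ⟧    ≡⟨ ∑-reindex (reflect-inverseOn K) (λ u → ⟦ L (reflect K t) <ᵇ L u ⟧) ⟩
    corank K L (reflect K t)                             ≡⟨ corank≡reflect-rank _ (reflect-< t<K) ⟩
    reflect K (rank K L (reflect K t))                   ∎
    where open ≡-Reasoning

  rcPerm-involutive : ∀ t → t < K → rcPerm K L (rcPerm K L′ t) ≡ t
  rcPerm-involutive t t<K = begin
    rcPerm K L (rcPerm K L′ t)                           ≡⟨ cong (rcPerm K L) rcPerm′≡u ⟩
    unrank K L (reflect K (rank K L (reflect K u)))      ≡⟨ cong (unrank K L) (trans (sym (rank-rcPerm-sequence u u<K)) rank′-u) ⟩
    unrank K L (rank K L t)                              ≡⟨ unrank-rank t t<K ⟩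
    t                                                    ∎
    where
    open ≡-Reasoning
    module R′ = RankProperties K L′ rcPerm-injectiveOn
    u : ℕ
    u = unrank K L′ (rank K L t)
    u<K : u < K
    u<K = proj₁ (R′.unrank-correct _ (rank-< t t<K))
    rank′-u : rank K L′ u ≡ rank K L t
    rank′-u = proj₂ (R′.unrank-correct _ (rank-< t t<K))
    rcPerm′≡u : rcPerm K L′ t ≡ u
    rcPerm′≡u = begin
      unrank K L′ (reflect K (rank K L′ (reflect K t)))                      ≡⟨ cong (unrank K L′ ∘ reflect K) (rank-rcPerm-sequence _ (reflect-< t<K)) ⟩
      unrank K L′ (reflect K (reflect K (rank K L (reflect K (reflect K t))))) ≡⟨ cong (unrank K L′) (reflect-involutive (rank-< _ (reflect-< (reflect-< t<K)))) ⟩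
      unrank K L′ (rank K L (reflect K (reflect K t)))                       ≡⟨ cong (unrank K L′ ∘ rank K L) (reflect-involutive t<K) ⟩
      u                                                                      ∎

module Window (s K : ℕ) where

  inWindow : ℕ → Bool
  inWindow x = (s ≤ᵇ x) ∧ (x <ᵇ s + K)

  data Position (x : ℕ) : Set where
    before : x < s → Position x
    inside : ∀ t → t < K → x ≡ s + t → Position x
    after  : s + K ≤ x → Position x

  position : ∀ x → Position x
  position x with x <? s | x <? s + K
  ... | yes x<s | _          = before x<s
  ... | no  x≮s | no  x≮s+K  = after (≮⇒≥ x≮s+K)
  ... | no  x≮s | yes x<s+K  = inside (x ∸ s) (subst (x ∸ s <_) (m+n∸m≡n s K) (∸-monoˡ-< x<s+K s≤x)) (sym (m+[n∸m]≡n s≤x))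
    where
    s≤x : s ≤ x
    s≤x = ≮⇒≥ x≮s

  inWindow-before : ∀ {x} → x < s → inWindow x ≡ false
  inWindow-before {x} x<s = cong (_∧ (x <ᵇ s + K)) (dec-false (s ≤? x) (<⇒≱ x<s))

  inWindow-inside : ∀ {t} → t < K → inWindow (s + t) ≡ true
  inWindow-inside {t} t<K = cong₂ _∧_ (dec-true (s ≤? s + t) (m≤m+n s t)) (<ᵇ-true (+-monoʳ-< s t<K))

  inWindow-after : ∀ {x} → s + K ≤ x → inWindow x ≡ false
  inWindow-after {x} s+K≤x = trans (cong ((s ≤ᵇ x) ∧_) (<ᵇ-false (≤⇒≯ s+K≤x))) (∧-zeroʳ (s ≤ᵇ x))

  <ᵇ-inside-outside : ∀ {x y} → inWindow x ≡ true → inWindow y ≡ false → (x <ᵇ y) ≡ (s <ᵇ y)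
  <ᵇ-inside-outside {x} {y} x∈ y∉ with position x | position y
  ... | before x<s | _ = contradiction (trans (sym x∈) (inWindow-before x<s)) λ ()
  ... | after s+K≤x | _ = contradiction (trans (sym x∈) (inWindow-after s+K≤x)) λ ()
  ... | inside _ _ _ | inside _ u<K refl = contradiction (trans (sym y∉) (inWindow-inside u<K)) λ ()
  ... | inside t _ refl | before y<s =
    trans (<ᵇ-false (<⇒≯ (<-≤-trans y<s (m≤m+n s t)))) (sym (<ᵇ-false (<⇒≯ y<s)))
  ... | inside t t<K refl | after s+K≤y =
    trans (<ᵇ-true s+t<y) (sym (<ᵇ-true (≤-<-trans (m≤m+n s t) s+t<y)))
    where
    s+t<y : s + t < y
    s+t<y = <-≤-trans (+-monoʳ-< s t<K) s+K≤y

  <ᵇ-outside-inside : ∀ {x y} → inWindow x ≡ false → inWindow y ≡ true → (x <ᵇ y) ≡ (x <ᵇ s)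
  <ᵇ-outside-inside {x} {y} x∉ y∈ with position x | position y
  ... | _ | before y<s = contradiction (trans (sym y∈) (inWindow-before y<s)) λ ()
  ... | _ | after s+K≤y = contradiction (trans (sym y∈) (inWindow-after s+K≤y)) λ ()
  ... | inside _ t<K refl | inside _ _ _ = contradiction (trans (sym x∉) (inWindow-inside t<K)) λ ()
  ... | before x<s | inside u _ refl =
    trans (<ᵇ-true (<-≤-trans x<s (m≤m+n s u))) (sym (<ᵇ-true x<s))
  ... | after s+K≤x | inside u u<K refl =
    trans (<ᵇ-false (<⇒≯ s+u<x)) (sym (<ᵇ-false (<⇒≯ (≤-<-trans (m≤m+n s u) s+u<x))))
    where
    s+u<x : s + u < x
    s+u<x = <-≤-trans (+-monoʳ-< s u<K) s+K≤x

  onWindow : (ℕ → ℕ) → ℕ → ℕ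
  onWindow p x = if inWindow x then s + p (x ∸ s) else x

  onWindow-inside : ∀ p {t} → t < K → onWindow p (s + t) ≡ s + p t
  onWindow-inside p {t} t<K rewrite inWindow-inside t<K | m+n∸m≡n s t = refl

  onWindow-outside : ∀ p {x} → inWindow x ≡ false → onWindow p x ≡ x
  onWindow-outside p x∉ rewrite x∉ = refl

  onWindow-outside₂ : ∀ p p′ {x} → inWindow x ≡ false → onWindow p′ (onWindow p x) ≡ x
  onWindow-outside₂ p p′ x∉ = trans (cong (onWindow p′) (onWindow-outside p x∉)) (onWindow-outside p′ x∉)

  onWindow-inWindow : ∀ {p} → (∀ t → t < K → p t < K) → ∀ {x} → inWindow x ≡ true → inWindow (onWindow p x) ≡ true
  onWindow-inWindow {p} p-< {x} x∈ with position x
  ... | before x<s      = contradiction (trans (sym x∈) (inWindow-before x<s)) λ ()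
  ... | after s+K≤x     = contradiction (trans (sym x∈) (inWindow-after s+K≤x)) λ ()
  ... | inside t t<K refl = trans (cong inWindow (onWindow-inside p t<K)) (inWindow-inside (p-< t t<K))

  rcWindow rcWindow⁻¹ : (ℕ → ℕ) → ℕ → ℕ
  rcWindow   f = onWindow (rcPerm   K (f ∘ (s +_)))
  rcWindow⁻¹ f = onWindow (rcPerm⁻¹ K (f ∘ (s +_)))

  module _ {n : ℕ} (s+K≤n : s + K ≤ n) where

    s+t<n : ∀ {t} → t < K → s + t < n
    s+t<n t<K = <-≤-trans (+-monoʳ-< s t<K) s+K≤n

    ∑-inWindow : ∀ (f : ℕ → ℕ) → ∑[ x < n ] (⟦ inWindow x ⟧ * f x) ≡ ∑[ t < K ] f (s + t)
    ∑-inWindow f = begin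
      ∑ n g                                                          ≡⟨ cong (λ N → ∑ N g) n≡s+[K+rest] ⟩
      ∑ (s + (K + rest)) g                                           ≡⟨ ∑-+ s (K + rest) g ⟩
      ∑ s g + ∑[ x < K + rest ] g (s + x)                            ≡⟨ cong (∑ s g +_) (∑-+ K rest (λ x → g (s + x))) ⟩
      ∑ s g + (∑[ t < K ] g (s + t) + ∑[ x < rest ] g (s + (K + x))) ≡⟨ cong₂ (λ a b → a + (∑[ t < K ] g (s + t) + b)) g-before g-after ⟩
      0 + (∑[ t < K ] g (s + t) + 0)                                 ≡⟨ +-identityʳ _ ⟩
      ∑[ t < K ] g (s + t)                                           ≡⟨ ∑-cong K (λ t t<K → trans (cong (λ b → ⟦ b ⟧ * f (s + t)) (inWindow-inside t<K)) (*-identityˡ _)) ⟩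
      ∑[ t < K ] f (s + t)                                           ∎
      where
      open ≡-Reasoning
      g : ℕ → ℕ
      g x = ⟦ inWindow x ⟧ * f x
      rest : ℕ
      rest = n ∸ (s + K)
      n≡s+[K+rest] : n ≡ s + (K + rest)
      n≡s+[K+rest] = sym (trans (sym (+-assoc s K rest)) (m+[n∸m]≡n s+K≤n))
      g-before : ∑ s g ≡ 0
      g-before = trans (∑-cong s (λ x x<s → cong (λ b → ⟦ b ⟧ * f x) (inWindow-before x<s))) (∑-zero s)
      g-after : ∑[ x < rest ] g (s + (K + x)) ≡ 0
      g-after = trans (∑-cong rest (λ x _ → cong (λ b → ⟦ b ⟧ * f (s + (K + x))) (inWindow-after (+-monoʳ-≤ s (m≤m+n K x))))) (∑-zero rest)

    inversionsInside inversionsAcross : (ℕ → ℕ) → ℕ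
    inversionsInside h = ∑[ x < n ] ∑[ y < n ] (⟦ inWindow x ∧ inWindow y ⟧ * ⟦ isInversion h x y ⟧)
    inversionsAcross h = ∑[ x < n ] ∑[ y < n ] (⟦ not (inWindow x ∧ inWindow y) ⟧ * ⟦ isInversion h x y ⟧)

    inversionCount-split : ∀ h → inversionCount n h ≡ inversionsInside h + inversionsAcross h
    inversionCount-split h = begin
      inversionCount n h
        ≡⟨ ∑-cong n (λ x _ → ∑-cong n (λ y _ → split-⟦⟧ (inWindow x ∧ inWindow y) _)) ⟩
      ∑[ x < n ] ∑[ y < n ] (insideTerm x y + acrossTerm x y)
        ≡⟨ ∑-cong n (λ x _ → ∑-distrib-+ n (insideTerm x) (acrossTerm x)) ⟩
      ∑[ x < n ] (∑[ y < n ] insideTerm x y + ∑[ y < n ] acrossTerm x y)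
        ≡⟨ ∑-distrib-+ n (λ x → ∑ n (insideTerm x)) (λ x → ∑ n (acrossTerm x)) ⟩
      inversionsInside h + inversionsAcross h
        ∎
      where
      open ≡-Reasoning
      insideTerm acrossTerm : ℕ → ℕ → ℕ
      insideTerm x y = ⟦ inWindow x ∧ inWindow y ⟧ * ⟦ isInversion h x y ⟧
      acrossTerm x y = ⟦ not (inWindow x ∧ inWindow y) ⟧ * ⟦ isInversion h x y ⟧

    inversionsInside≡inversionCount : ∀ h → inversionsInside h ≡ inversionCount K (h ∘ (s +_))
    inversionsInside≡inversionCount h = begin
      inversionsInside h                                                           ≡⟨ ∑-cong n (λ x _ → ∑-cong n (λ y _ → factor x y)) ⟩
      ∑[ x < n ] ∑[ y < n ] (⟦ inWindow x ⟧ * (⟦ inWindow y ⟧ * inv x y))          ≡⟨ ∑-cong n (λ x _ → ∑-distribˡ-* n ⟦ inWindow x ⟧ _) ⟩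
      ∑[ x < n ] (⟦ inWindow x ⟧ * ∑[ y < n ] (⟦ inWindow y ⟧ * inv x y))          ≡⟨ ∑-inWindow _ ⟩
      ∑[ a < K ] ∑[ y < n ] (⟦ inWindow y ⟧ * inv (s + a) y)                       ≡⟨ ∑-cong K (λ a _ → ∑-inWindow _) ⟩
      ∑[ a < K ] ∑[ b < K ] inv (s + a) (s + b)                                    ≡⟨ ∑-cong K (λ a _ → ∑-cong K (λ b _ → cong (λ c → ⟦ c ∧ (h (s + b) <ᵇ h (s + a)) ⟧) (s+-<ᵇ a b))) ⟩
      inversionCount K (h ∘ (s +_))                                                ∎
      where
      open ≡-Reasoning
      inv : ℕ → ℕ → ℕ
      inv x y = ⟦ isInversion h x y ⟧
      factor : ∀ x y → ⟦ inWindow x ∧ inWindow y ⟧ * inv x y ≡ ⟦ inWindow x ⟧ * (⟦ inWindow y ⟧ * inv x y)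
      factor x y = trans (cong (_* inv x y) (⟦∧⟧ (inWindow x) (inWindow y))) (*-assoc ⟦ inWindow x ⟧ _ _)
      s+-<ᵇ : ∀ a b → (s + a <ᵇ s + b) ≡ (a <ᵇ b)
      s+-<ᵇ a b = <ᵇ-cong (+-cancelˡ-< s a b) (+-monoʳ-< s)

    module _ {π ρ : ℕ → ℕ} (π-inverse : InverseOn n π ρ)
             (π-outside : ∀ {x} → inWindow x ≡ false → π x ≡ x)
             (π-inside : ∀ {x} → inWindow x ≡ true → inWindow (π x) ≡ true) where

      open InverseOn π-inverse

      ρ-outside : ∀ {x} → x < n → inWindow x ≡ false → ρ x ≡ x
      ρ-outside {x} x<n x∉ with inWindow (ρ x) in ρx∈?
      ... | false = trans (sym (π-outside ρx∈?)) (π∘ρ x x<n)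
      ... | true  = contradiction (trans (sym (π-inside ρx∈?)) (trans (cong inWindow (π∘ρ x x<n)) x∉)) λ ()

      inWindow-ρ : ∀ {x} → x < n → inWindow (ρ x) ≡ inWindow x
      inWindow-ρ {x} x<n with inWindow x in x∈? | inWindow (ρ x) in ρx∈?
      ... | true  | true  = refl
      ... | false | _     = trans (sym ρx∈?) (trans (cong inWindow (ρ-outside x<n x∈?)) x∈?)
      ... | true  | false = contradiction (trans (sym x∈?) (trans (cong inWindow (sym (π∘ρ x x<n))) (trans (cong inWindow (π-outside ρx∈?)) ρx∈?))) λ ()

      -- ρ fixes outside positions, keeps the window in place, and a window position compares with
      -- an outside one as s does.
      ρ-<ᵇ : ∀ {x y} → x < n → y < n → inWindow x ∧ inWindow y ≡ false → (ρ x <ᵇ ρ y) ≡ (x <ᵇ y)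
      ρ-<ᵇ {x} {y} x<n y<n not-both with inWindow x in x∈? | inWindow y in y∈?
      ... | true  | true  = contradiction not-both λ ()
      ... | false | false = cong₂ _<ᵇ_ (ρ-outside x<n x∈?) (ρ-outside y<n y∈?)
      ... | true  | false = begin
        (ρ x <ᵇ ρ y)  ≡⟨ cong (ρ x <ᵇ_) (ρ-outside y<n y∈?) ⟩
        (ρ x <ᵇ y)    ≡⟨ <ᵇ-inside-outside (trans (inWindow-ρ x<n) x∈?) y∈? ⟩
        (s <ᵇ y)      ≡⟨ <ᵇ-inside-outside x∈? y∈? ⟨
        (x <ᵇ y)      ∎
        where open ≡-Reasoning
      ... | false | true  = begin
        (ρ x <ᵇ ρ y)  ≡⟨ cong (_<ᵇ ρ y) (ρ-outside x<n x∈?) ⟩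
        (x <ᵇ ρ y)    ≡⟨ <ᵇ-outside-inside x∈? (trans (inWindow-ρ y<n) y∈?) ⟩
        (x <ᵇ s)      ≡⟨ <ᵇ-outside-inside x∈? y∈? ⟨
        (x <ᵇ y)      ∎
        where open ≡-Reasoning

      inversionsAcross-∘ : ∀ f → inversionsAcross (f ∘ π) ≡ inversionsAcross f
      inversionsAcross-∘ f = begin
        ∑[ x < n ] ∑[ y < n ] term (f ∘ π) x y              ≡⟨ ∑-reindex ρ-inverse (λ x → ∑[ y < n ] term (f ∘ π) x y) ⟨
        ∑[ x < n ] ∑[ y < n ] term (f ∘ π) (ρ x) y          ≡⟨ ∑-cong n (λ x _ → ∑-reindex ρ-inverse (term (f ∘ π) (ρ x))) ⟨
        ∑[ x < n ] ∑[ y < n ] term (f ∘ π) (ρ x) (ρ y)      ≡⟨ ∑-cong n (λ x x<n → ∑-cong n (λ y y<n → term-ρ x<n y<n)) ⟩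
        ∑[ x < n ] ∑[ y < n ] term f x y                    ∎
        where
        open ≡-Reasoning
        ρ-inverse : InverseOn n ρ π
        ρ-inverse = InverseOn-sym π-inverse
        term : (ℕ → ℕ) → ℕ → ℕ → ℕ
        term h x y = ⟦ not (inWindow x ∧ inWindow y) ⟧ * ⟦ isInversion h x y ⟧
        term-ρ : ∀ {x y} → x < n → y < n → term (f ∘ π) (ρ x) (ρ y) ≡ term f x y
        term-ρ {x} {y} x<n y<n
          rewrite π∘ρ x x<n | π∘ρ y y<n | inWindow-ρ x<n | inWindow-ρ y<n
          with inWindow x ∧ inWindow y in both?
        ... | true  = refl
        ... | false = cong (λ c → 1 * ⟦ c ∧ (f y <ᵇ f x) ⟧) (ρ-<ᵇ x<n y<n both?)

      inversionCount-∘ : ∀ f → inversionCount K (f ∘ π ∘ (s +_)) ≡ inversionCount K (f ∘ (s +_)) →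
                         inversionCount n (f ∘ π) ≡ inversionCount n f
      inversionCount-∘ f insideEq = begin
        inversionCount n (f ∘ π)                               ≡⟨ inversionCount-split (f ∘ π) ⟩
        inversionsInside (f ∘ π) + inversionsAcross (f ∘ π)    ≡⟨ cong₂ _+_ inside-∘ (inversionsAcross-∘ f) ⟩
        inversionsInside f + inversionsAcross f                ≡⟨ inversionCount-split f ⟨
        inversionCount n f                                     ∎
        where
        open ≡-Reasoning
        inside-∘ : inversionsInside (f ∘ π) ≡ inversionsInside f
        inside-∘ = trans (inversionsInside≡inversionCount (f ∘ π))
                         (trans insideEq (sym (inversionsInside≡inversionCount f)))

    module _ {p q : ℕ → ℕ} (p-inverse : InverseOn K p q) where

      open InverseOn p-inverse

      onWindow-inverseOn : InverseOn n (onWindow p) (onWindow q)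
      onWindow-inverseOn = record
        { π-< = bounded p π-<
        ; ρ-< = bounded q ρ-<
        ; ρ∘π = cancel p q π-< ρ∘π
        ; π∘ρ = cancel q p ρ-< π∘ρ
        }
        where
        bounded : ∀ r → (∀ t → t < K → r t < K) → ∀ x → x < n → onWindow r x < n
        bounded r r-< x x<n with position x
        ... | before x<s        = subst (_< n) (sym (onWindow-outside r (inWindow-before x<s))) x<n
        ... | after s+K≤x       = subst (_< n) (sym (onWindow-outside r (inWindow-after s+K≤x))) x<n
        ... | inside t t<K refl = subst (_< n) (sym (onWindow-inside r t<K)) (s+t<n (r-< t t<K))
        cancel : ∀ r r′ → (∀ t → t < K → r t < K) → (∀ t → t < K → r′ (r t) ≡ t) →
                 ∀ x → x < n → onWindow r′ (onWindow r x) ≡ x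
        cancel r r′ r-< r′∘r x _ with position x
        ... | before x<s        = onWindow-outside₂ r r′ (inWindow-before x<s)
        ... | after s+K≤x       = onWindow-outside₂ r r′ (inWindow-after s+K≤x)
        ... | inside t t<K refl = begin
          onWindow r′ (onWindow r (s + t))  ≡⟨ cong (onWindow r′) (onWindow-inside r t<K) ⟩
          onWindow r′ (s + r t)             ≡⟨ onWindow-inside r′ (r-< t t<K) ⟩
          s + r′ (r t)                      ≡⟨ cong (s +_) (r′∘r t t<K) ⟩
          s + t                             ∎
          where open ≡-Reasoning

    module _ {f : ℕ → ℕ} (f-injective : InjectiveOn n f) where

      window-injectiveOn : InjectiveOn K (f ∘ (s +_))
      window-injectiveOn a b a<K b<K eq = +-cancelˡ-≡ s a b (f-injective _ _ (s+t<n a<K) (s+t<n b<K) eq)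

      private
        module Rank = RankProperties K (f ∘ (s +_)) window-injectiveOn
        rc : ℕ → ℕ
        rc = rcPerm K (f ∘ (s +_))

      rcWindow-inverseOn : InverseOn n (rcWindow f) (rcWindow⁻¹ f)
      rcWindow-inverseOn = onWindow-inverseOn Rank.rcPerm-inverseOn

      inversionCount-rcWindow : inversionCount n (f ∘ rcWindow f) ≡ inversionCount n f
      inversionCount-rcWindow =
        inversionCount-∘ rcWindow-inverseOn (onWindow-outside rc) (onWindow-inWindow (InverseOn.π-< Rank.rcPerm-inverseOn)) f
          (trans (inversionCount-cong K (λ t t<K → cong f (onWindow-inside rc t<K))) Rank.inversionCount-rcPerm)

      rcWindow-<ᵇ : ∀ {a b} → a < K → b < K →
                    (f (rcWindow f (s + a)) <ᵇ f (rcWindow f (s + b))) ≡ (f (s + reflect K b) <ᵇ f (s + reflect K a))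
      rcWindow-<ᵇ a<K b<K =
        trans (cong₂ (λ x y → f x <ᵇ f y) (onWindow-inside rc a<K) (onWindow-inside rc b<K)) (Rank.rcPerm-<ᵇ a<K b<K)

      rcWindow-involutive : ∀ {g} → (∀ x → x < n → g x ≡ f (rcWindow f x)) → ∀ x → x < n → rcWindow f (rcWindow g x) ≡ x
      rcWindow-involutive {g} g≗f∘rc x x<n with position x
      ... | before x<s        = onWindow-outside₂ (rcPerm K (g ∘ (s +_))) rc (inWindow-before x<s)
      ... | after s+K≤x       = onWindow-outside₂ (rcPerm K (g ∘ (s +_))) rc (inWindow-after s+K≤x)
      ... | inside t t<K refl = begin
        rcWindow f (rcWindow g (s + t))   ≡⟨ cong (rcWindow f) (onWindow-inside rc′ t<K) ⟩
        rcWindow f (s + rc′ t)            ≡⟨ onWindow-inside rc (InverseOn.π-< Rank′.rcPerm-inverseOn t t<K) ⟩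
        s + rc (rc′ t)                    ≡⟨ cong (s +_) (rcPerm-involutive window-injectiveOn window-g t t<K) ⟩
        s + t                             ∎
        where
        open ≡-Reasoning
        rc′ : ℕ → ℕ
        rc′ = rcPerm K (g ∘ (s +_))
        window-g : ∀ t → t < K → g (s + t) ≡ f (s + rc t)
        window-g t t<K = trans (g≗f∘rc (s + t) (s+t<n t<K)) (cong f (onWindow-inside rc t<K))
        module Rank′ = RankProperties K (g ∘ (s +_)) (rcPerm-injectiveOn window-injectiveOn window-g)

val-lookup : ∀ {n} (σ : Vec (Fin n) n) (a : Fin n) → val σ (toℕ a) ≡ toℕ (lookup σ a)
val-lookup = nth-lookup
  where
  nth-lookup : ∀ {N len} (v : Vec (Fin N) len) (a : Fin len) → nth (toList (mapᵥ toℕ v)) (toℕ a) ≡ toℕ (lookup v a)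
  nth-lookup (x ∷ᵥ v) Fin.zero    = refl
  nth-lookup (x ∷ᵥ v) (Fin.suc a) = nth-lookup v a

val-fromℕ< : ∀ {n} (σ : Vec (Fin n) n) {x} (x<n : x < n) → val σ x ≡ toℕ (lookup σ (fromℕ< x<n))
val-fromℕ< σ x<n = trans (cong (val σ) (sym (Finₚ.toℕ-fromℕ< x<n))) (val-lookup σ (fromℕ< x<n))

val-injective : ∀ {n} {σ σ′ : Vec (Fin n) n} → (∀ x → x < n → val σ x ≡ val σ′ x) → σ ≡ σ′
val-injective {n} {σ} {σ′} val≗ = begin
  σ                    ≡⟨ Vecₚ.tabulate∘lookup σ ⟨
  tabulate (lookup σ)  ≡⟨ Vecₚ.tabulate-cong lookup≗ ⟩
  tabulate (lookup σ′) ≡⟨ Vecₚ.tabulate∘lookup σ′ ⟩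
  σ′                   ∎
  where
  open ≡-Reasoning
  lookup≗ : ∀ a → lookup σ a ≡ lookup σ′ a
  lookup≗ a = Finₚ.toℕ-injective (trans (sym (val-lookup σ a)) (trans (val≗ (toℕ a) (Finₚ.toℕ<n a)) (val-lookup σ′ a)))

-- The fallback `a` is junk: `permute` is only applied to maps sending [0,n) into itself.
fromℕ-or : ∀ {n} → ℕ → Fin n → Fin n
fromℕ-or {n} y a with y <? n
... | yes y<n = fromℕ< y<n
... | no  _   = a

toℕ-fromℕ-or : ∀ {n} {y} (a : Fin n) → y < n → toℕ (fromℕ-or y a) ≡ y
toℕ-fromℕ-or {n} {y} a y<n with y <? n
... | yes y<n′ = Finₚ.toℕ-fromℕ< y<n′
... | no  y≮n  = contradiction y<n y≮n

permute : ∀ {n} → (ℕ → ℕ) → Vec (Fin n) n → Vec (Fin n) n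
permute π σ = tabulate (λ a → lookup σ (fromℕ-or (π (toℕ a)) a))

val-permute : ∀ {n} (π : ℕ → ℕ) (σ : Vec (Fin n) n) {x} → x < n → π x < n → val (permute π σ) x ≡ val σ (π x)
val-permute {n} π σ {x} x<n πx<n = begin
  val (permute π σ) x                                   ≡⟨ val-fromℕ< (permute π σ) x<n ⟩
  toℕ (lookup (permute π σ) a)                          ≡⟨ cong toℕ (Vecₚ.lookup∘tabulate _ a) ⟩
  toℕ (lookup σ (fromℕ-or (π (toℕ a)) a))               ≡⟨ val-lookup σ _ ⟨
  val σ (toℕ (fromℕ-or (π (toℕ a)) a))                  ≡⟨ cong (val σ) (toℕ-fromℕ-or a (subst (λ y → π y < n) (sym toℕa≡x) πx<n)) ⟩
  val σ (π (toℕ a))                                     ≡⟨ cong (val σ ∘ π) toℕa≡x ⟩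
  val σ (π x)                                           ∎
  where
  open ≡-Reasoning
  a : Fin n
  a = fromℕ< x<n
  toℕa≡x : toℕ a ≡ x
  toℕa≡x = Finₚ.toℕ-fromℕ< x<n

rcVec : ∀ {n} → ℕ → ℕ → Vec (Fin n) n → Vec (Fin n) n
rcVec s K σ = permute (Window.rcWindow s K (val σ)) σ

module RcVec {n : ℕ} (s K : ℕ) (s+K≤n : s + K ≤ n) where

  open Window s K

  module _ (σ : Vec (Fin n) n) (σ-injective : InjectiveOn n (val σ)) where

    private
      module Inv = InverseOn (rcWindow-inverseOn s+K≤n σ-injective)

    val-rcVec : ∀ x → x < n → val (rcVec s K σ) x ≡ val σ (rcWindow (val σ) x)
    val-rcVec x x<n = val-permute (rcWindow (val σ)) σ x<n (Inv.π-< x x<n)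

    rcVec-injectiveOn : InjectiveOn n (val (rcVec s K σ))
    rcVec-injectiveOn x y x<n y<n eq = InjectiveOn-∘ σ-injective (rcWindow-inverseOn s+K≤n σ-injective) x y x<n y<n
      (trans (sym (val-rcVec x x<n)) (trans eq (val-rcVec y y<n)))

    inversionCount-rcVec : inversionCount n (val (rcVec s K σ)) ≡ inversionCount n (val σ)
    inversionCount-rcVec = trans (inversionCount-cong n val-rcVec) (inversionCount-rcWindow s+K≤n σ-injective)

    rcVec-<ᵇ : ∀ {a b} → a < K → b < K →
               (val (rcVec s K σ) (s + a) <ᵇ val (rcVec s K σ) (s + b)) ≡ (val σ (s + reflect K b) <ᵇ val σ (s + reflect K a))
    rcVec-<ᵇ a<K b<K = trans (cong₂ _<ᵇ_ (val-rcVec _ (s+t<n s+K≤n a<K)) (val-rcVec _ (s+t<n s+K≤n b<K)))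
                             (rcWindow-<ᵇ s+K≤n σ-injective a<K b<K)

  rcVec-involutive : ∀ σ → InjectiveOn n (val σ) → rcVec s K (rcVec s K σ) ≡ σ
  rcVec-involutive σ σ-injective = val-injective λ x x<n → begin
    val (rcVec s K σ′) x                            ≡⟨ val-rcVec σ′ σ′-injective x x<n ⟩
    val σ′ (rcWindow (val σ′) x)                    ≡⟨ val-rcVec σ σ-injective _ (InverseOn.π-< (rcWindow-inverseOn s+K≤n σ′-injective) x x<n) ⟩
    val σ (rcWindow (val σ) (rcWindow (val σ′) x))  ≡⟨ cong (val σ) (rcWindow-involutive s+K≤n σ-injective (val-rcVec σ σ-injective) x x<n) ⟩
    val σ x                                         ∎
    where
    open ≡-Reasoning
    σ′ : Vec (Fin n) n
    σ′ = rcVec s K σ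
    σ′-injective : InjectiveOn n (val σ′)
    σ′-injective = rcVec-injectiveOn σ σ-injective

length-filterᵇ : ∀ {A : Set} (p : A → Bool) xs → length (filterᵇ p xs) ≡ sum (map (⟦_⟧ ∘ p) xs)
length-filterᵇ p []       = refl
length-filterᵇ p (x ∷ xs) with p x
... | true  = cong suc (length-filterᵇ p xs)
... | false = length-filterᵇ p xs

sum-cartesianProduct : ∀ {A B : Set} (h : A × B → ℕ) xs ys →
                       sum (map h (cartesianProduct xs ys)) ≡ sum (map (λ a → sum (map (λ b → h (a , b)) ys)) xs)
sum-cartesianProduct h []       ys = refl
sum-cartesianProduct h (x ∷ xs) ys = begin
  sum (map h (map (x ,_) ys ++ cartesianProduct xs ys))                ≡⟨ cong sum (Listₚ.map-++ h (map (x ,_) ys) _) ⟩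
  sum (map h (map (x ,_) ys) ++ map h (cartesianProduct xs ys))        ≡⟨ sum-++ (map h (map (x ,_) ys)) _ ⟩
  sum (map h (map (x ,_) ys)) + sum (map h (cartesianProduct xs ys))   ≡⟨ cong₂ _+_ (sym (cong sum (Listₚ.map-∘ ys))) (sum-cartesianProduct h xs ys) ⟩
  sum (map (λ b → h (x , b)) ys) + sum (map (λ a → sum (map (λ b → h (a , b)) ys)) xs) ∎
  where open ≡-Reasoning

sum-allFin : ∀ N (g : ℕ → ℕ) → sum (map (g ∘ toℕ) (allFin N)) ≡ ∑ N g
sum-allFin N g = trans (cong sum (Listₚ.map-tabulate {n = N} (λ a → a) (g ∘ toℕ))) (sum-tabulate N g)
  where
  sum-tabulate : ∀ N (g : ℕ → ℕ) → sum (Data.List.tabulate {n = N} (g ∘ toℕ)) ≡ ∑ N g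
  sum-tabulate zero    g = refl
  sum-tabulate (suc N) g = cong (g 0 +_) (sum-tabulate N (g ∘ suc))

sum-pairs : ∀ N (g : ℕ → ℕ → ℕ) → sum (map (λ (a , b) → g (toℕ a) (toℕ b)) (pairs N)) ≡ ∑[ x < N ] ∑[ y < N ] g x y
sum-pairs N g = begin
  sum (map (λ (a , b) → g (toℕ a) (toℕ b)) (pairs N))                   ≡⟨ sum-cartesianProduct _ (allFin N) (allFin N) ⟩
  sum (map (λ a → sum (map (λ b → g (toℕ a) (toℕ b)) (allFin N))) (allFin N)) ≡⟨ cong sum (Listₚ.map-cong (λ a → sum-allFin N (g (toℕ a))) (allFin N)) ⟩
  sum (map (λ a → ∑ N (g (toℕ a))) (allFin N))                          ≡⟨ sum-allFin N (λ x → ∑ N (g x)) ⟩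
  ∑[ x < N ] ∑[ y < N ] g x y                                          ∎
  where open ≡-Reasoning

inversions≡inversionCount : ∀ {n} (σ : Vec (Fin n) n) → inversions σ ≡ inversionCount n (val σ)
inversions≡inversionCount {n} σ = begin
  inversions σ                                                          ≡⟨ length-filterᵇ _ (pairs n) ⟩
  sum (map (λ (a , b) → ⟦ inverted a b ⟧) (pairs n))                    ≡⟨ cong sum (Listₚ.map-cong (λ (a , b) → cong ⟦_⟧ (inverted≡ a b)) (pairs n)) ⟩
  sum (map (λ (a , b) → ⟦ isInversion (val σ) (toℕ a) (toℕ b) ⟧) (pairs n)) ≡⟨ sum-pairs n (λ x y → ⟦ isInversion (val σ) x y ⟧) ⟩
  inversionCount n (val σ)                                              ∎
  where
  open ≡-Reasoning
  inverted : Fin n → Fin n → Bool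
  inverted a b = (toℕ a <ᵇ toℕ b) ∧ (toℕ (lookup σ b) <ᵇ toℕ (lookup σ a))
  inverted≡ : ∀ a b → inverted a b ≡ isInversion (val σ) (toℕ a) (toℕ b)
  inverted≡ a b = cong₂ (λ u v → (toℕ a <ᵇ toℕ b) ∧ (u <ᵇ v)) (sym (val-lookup σ b)) (sym (val-lookup σ a))

allᵇ-pairs : ∀ {k} (p : Fin k × Fin k → Bool) → T (allᵇ p (pairs k)) ⇔ (∀ a b → T (p (a , b)))
allᵇ-pairs {k} p = mk⇔
  (λ all-p a b → All.lookup (Allₚ.all⁺ p (pairs k) all-p) (∈-cartesianProduct⁺ (∈-allFin a) (∈-allFin b)))
  (λ p-all → Allₚ.all⁻ p {xs = pairs k} (All.tabulate (λ { {a , b} _ → p-all a b })))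

distinctᵇ⇔injectiveOn : ∀ {n} (σ : Vec (Fin n) n) → T (distinctᵇ σ) ⇔ InjectiveOn n (val σ)
distinctᵇ⇔injectiveOn {n} σ = mk⇔ to from
  where
  distinctPair : Fin n × Fin n → Bool
  distinctPair (a , b) = ⌊ a ≟ᶠ b ⌋ ∨ not ⌊ lookup σ a ≟ᶠ lookup σ b ⌋
  lookup-injective : ∀ a b → T (⌊ a ≟ᶠ b ⌋ ∨ not ⌊ lookup σ a ≟ᶠ lookup σ b ⌋) → lookup σ a ≡ lookup σ b → a ≡ b
  lookup-injective a b distinct eq with a ≟ᶠ b | lookup σ a ≟ᶠ lookup σ b
  ... | yes a≡b | _        = a≡b
  ... | no  _   | no  σa≢σb = contradiction eq σa≢σb
  to : T (distinctᵇ σ) → InjectiveOn n (val σ)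
  to distinct x y x<n y<n eq = begin
    x                    ≡⟨ Finₚ.toℕ-fromℕ< x<n ⟨
    toℕ (fromℕ< x<n)     ≡⟨ cong toℕ (lookup-injective _ _ (Equivalence.to (allᵇ-pairs distinctPair) distinct _ _) lookup≡) ⟩
    toℕ (fromℕ< y<n)     ≡⟨ Finₚ.toℕ-fromℕ< y<n ⟩
    y                    ∎
    where
    open ≡-Reasoning
    lookup≡ : lookup σ (fromℕ< x<n) ≡ lookup σ (fromℕ< y<n)
    lookup≡ = Finₚ.toℕ-injective (trans (sym (val-fromℕ< σ x<n)) (trans eq (val-fromℕ< σ y<n)))
  from : InjectiveOn n (val σ) → T (distinctᵇ σ)
  from σ-injective = Equivalence.from (allᵇ-pairs distinctPair) distinct
    where
    distinct : ∀ a b → T (⌊ a ≟ᶠ b ⌋ ∨ not ⌊ lookup σ a ≟ᶠ lookup σ b ⌋)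
    distinct a b with a ≟ᶠ b | lookup σ a ≟ᶠ lookup σ b
    ... | yes _   | _        = _
    ... | no  _   | no  _    = _
    ... | no  a≢b | yes σa≡σb = a≢b (Finₚ.toℕ-injective (σ-injective _ _ (Finₚ.toℕ<n a) (Finₚ.toℕ<n b)
                                  (trans (val-lookup σ a) (trans (cong toℕ σa≡σb) (sym (val-lookup σ b))))))

PatternAt : ∀ {k} → Vec (Fin k) k → (ℕ → ℕ) → ℕ → Set
PatternAt τ f p = ∀ a b → (toℕ (lookup τ a) <ᵇ toℕ (lookup τ b)) ≡ (f (p + toℕ a) <ᵇ f (p + toℕ b))

occursAt⇔PatternAt : ∀ {n k} (τ : Vec (Fin k) k) (σ : Vec (Fin n) n) i → T (occursAt τ σ i) ⇔ PatternAt τ (val σ) (i ∸ 1)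
occursAt⇔PatternAt τ σ i = mk⇔
  (λ occ a b → Equivalence.to (T-not-xor _ _) (Equivalence.to (allᵇ-pairs _) occ a b))
  (λ pat → Equivalence.from (allᵇ-pairs _) (λ a b → Equivalence.from (T-not-xor _ _) (pat a b)))
  where
  T-not-xor : ∀ x y → T (not (x xor y)) ⇔ x ≡ y
  T-not-xor true  true  = mk⇔ (λ _ → refl) _
  T-not-xor true  false = mk⇔ (λ ()) (λ ())
  T-not-xor false true  = mk⇔ (λ ()) (λ ())
  T-not-xor false false = mk⇔ (λ _ → refl) _

allWords-complete : ∀ k n (v : Vec (Fin n) k) → v ∈ allWords k n
allWords-complete zero    n Data.Vec.[] = here refl
allWords-complete (suc k) n (x ∷ᵥ v) =
  ∈-concatMap⁺ (λ y → map (y ∷ᵥ_) (allWords k n))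
    (Data.List.Relation.Unary.Any.map (λ { refl → ∈-map⁺ (x ∷ᵥ_) (allWords-complete k n v) }) (∈-allFin x))

allWords-unique : ∀ k n → Unique (allWords k n)
allWords-unique zero    n = [] ∷ []
allWords-unique (suc k) n = subst Unique (sym (allWords-as-product (allFin n)))
  (Uniqueₚ.map⁺ ∷-injective (Uniqueₚ.cartesianProduct⁺ (Uniqueₚ.allFin⁺ n) (allWords-unique k n)))
  where
  allWords-as-product : ∀ xs → concatMap (λ x → map (x ∷ᵥ_) (allWords k n)) xs
                               ≡ map (uncurry _∷ᵥ_) (cartesianProduct xs (allWords k n))
  allWords-as-product []       = refl
  allWords-as-product (x ∷ xs) = trans (cong₂ _++_ (Listₚ.map-∘ (allWords k n)) (allWords-as-product xs))
                                       (sym (Listₚ.map-++ (uncurry _∷ᵥ_) (map (x ,_) (allWords k n)) _))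
  ∷-injective : ∀ {p q : Fin n × Vec (Fin n) k} → uncurry _∷ᵥ_ p ≡ uncurry _∷ᵥ_ q → p ≡ q
  ∷-injective {x , v} {y , w} eq with refl , refl ← Vecₚ.∷-injective eq = refl

∈-filterᵇ : ∀ {A : Set} (p : A → Bool) {xs x} → x ∈ filterᵇ p xs ⇔ (x ∈ xs × T (p x))
∈-filterᵇ p = mk⇔ (∈-filter⁻ (T? ∘ p)) (uncurry (∈-filter⁺ (T? ∘ p)))

∈-permsWithInv : ∀ {n m} {σ : Vec (Fin n) n} →
                 σ ∈ permsWithInv n m ⇔ (InjectiveOn n (val σ) × inversionCount n (val σ) ≡ m)
∈-permsWithInv {n} {m} {σ} = mk⇔ to from
  where
  ok : Vec (Fin n) n → Bool
  ok σ = distinctᵇ σ ∧ (inversions σ ≡ᵇ m)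
  to : σ ∈ permsWithInv n m → InjectiveOn n (val σ) × inversionCount n (val σ) ≡ m
  to σ∈ = let _ , σ-ok = Equivalence.to (∈-filterᵇ ok {allWords n n}) σ∈
              distinct , inv≡m = Equivalence.to T-∧ σ-ok
          in Equivalence.to (distinctᵇ⇔injectiveOn σ) distinct ,
             trans (sym (inversions≡inversionCount σ)) (≡ᵇ⇒≡ _ m inv≡m)
  from : InjectiveOn n (val σ) × inversionCount n (val σ) ≡ m → σ ∈ permsWithInv n m
  from (σ-injective , inv≡m) = Equivalence.from (∈-filterᵇ ok {allWords n n}) (allWords-complete n n σ ,
    Equivalence.from T-∧ (Equivalence.from (distinctᵇ⇔injectiveOn σ) σ-injective ,
                          ≡⇒≡ᵇ _ m (trans (inversions≡inversionCount σ) inv≡m)))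

permsWithInv-unique : ∀ n m → Unique (permsWithInv n m)
permsWithInv-unique n m = Uniqueₚ.filter⁺ _ (allWords-unique n n)

module _ {n m k : ℕ} (τ : Vec (Fin k) k) where

  occurrences : ℕ → List (Vec (Fin n) n)
  occurrences i = filterᵇ (λ σ → occursAt τ σ i) (permsWithInv n m)

  record Occurrence (p : ℕ) (σ : Vec (Fin n) n) : Set where
    constructor occurrence
    field
      injective       : InjectiveOn n (val σ)
      inversionCount≡ : inversionCount n (val σ) ≡ m
      patternAt       : PatternAt τ (val σ) p

  ∈-occurrences : ∀ {p σ} → σ ∈ occurrences (suc p) ⇔ Occurrence p σ
  ∈-occurrences {p} {σ} = mk⇔
    (λ σ∈ → let σ∈perms , occ = Equivalence.to (∈-filterᵇ (λ σ → occursAt τ σ (suc p)) {permsWithInv n m}) σ∈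
                σ-injective , inv≡m = Equivalence.to ∈-permsWithInv σ∈perms
            in occurrence σ-injective inv≡m (Equivalence.to (occursAt⇔PatternAt τ σ (suc p)) occ))
    (λ (occurrence σ-injective inv≡m pat) → Equivalence.from (∈-filterᵇ (λ σ → occursAt τ σ (suc p)) {permsWithInv n m})
       (Equivalence.from ∈-permsWithInv (σ-injective , inv≡m) , Equivalence.from (occursAt⇔PatternAt τ σ (suc p)) pat))

  occurrences-unique : ∀ i → Unique (occurrences i)
  occurrences-unique i = Uniqueₚ.filter⁺ (λ σ → T? (occursAt τ σ i)) (permsWithInv-unique n m)

  module Slide {s : ℕ} (s+k<n : s + k < n) where

    s+[1+k]≤n : s + suc k ≤ n
    s+[1+k]≤n = subst (_≤ n) (sym (+-suc s k)) s+k<n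

    -- The wide window covers the occurrence at s and the next position; reverse-complementing it
    -- moves a reverse-complemented copy of the occurrence to s+1, which the narrow window turns
    -- back into τ.
    slideRight slideLeft : Vec (Fin n) n → Vec (Fin n) n
    slideRight = rcVec (suc s) k ∘ rcVec s (suc k)
    slideLeft  = rcVec s (suc k) ∘ rcVec (suc s) k

    private
      module Wide   = RcVec s (suc k) s+[1+k]≤n
      module Narrow = RcVec (suc s) k s+k<n

    module _ (σ : Vec (Fin n) n) (σ-injective : InjectiveOn n (val σ)) where

      private
        wide-injectiveOn : InjectiveOn n (val (rcVec s (suc k) σ))
        wide-injectiveOn = Wide.rcVec-injectiveOn σ σ-injective
        narrow-injectiveOn : InjectiveOn n (val (rcVec (suc s) k σ))
        narrow-injectiveOn = Narrow.rcVec-injectiveOn σ σ-injective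

      slideRight-<ᵇ : ∀ {a b} → a < k → b < k →
                      (val (slideRight σ) (suc s + a) <ᵇ val (slideRight σ) (suc s + b)) ≡ (val σ (s + a) <ᵇ val σ (s + b))
      slideRight-<ᵇ {a} {b} a<k b<k = begin
        (val (rcVec (suc s) k σʷ) (suc s + a) <ᵇ val (rcVec (suc s) k σʷ) (suc s + b))
          ≡⟨ Narrow.rcVec-<ᵇ σʷ wide-injectiveOn a<k b<k ⟩
        (val σʷ (suc s + reflect k b) <ᵇ val σʷ (suc s + reflect k a))
          ≡⟨ cong₂ (λ x y → val σʷ x <ᵇ val σʷ y) (+-suc s _) (+-suc s _) ⟨
        (val σʷ (s + suc (reflect k b)) <ᵇ val σʷ (s + suc (reflect k a)))
          ≡⟨ Wide.rcVec-<ᵇ σ σ-injective (s≤s (reflect-< b<k)) (s≤s (reflect-< a<k)) ⟩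
        (val σ (s + reflect k (reflect k a)) <ᵇ val σ (s + reflect k (reflect k b)))
          ≡⟨ cong₂ (λ x y → val σ (s + x) <ᵇ val σ (s + y)) (reflect-involutive a<k) (reflect-involutive b<k) ⟩
        (val σ (s + a) <ᵇ val σ (s + b))
          ∎
        where
        open ≡-Reasoning
        σʷ : Vec (Fin n) n
        σʷ = rcVec s (suc k) σ

      slideLeft-<ᵇ : ∀ {a b} → a < k → b < k →
                     (val (slideLeft σ) (s + a) <ᵇ val (slideLeft σ) (s + b)) ≡ (val σ (suc s + a) <ᵇ val σ (suc s + b))
      slideLeft-<ᵇ {a} {b} a<k b<k = begin
        (val (rcVec s (suc k) σⁿ) (s + a) <ᵇ val (rcVec s (suc k) σⁿ) (s + b))
          ≡⟨ Wide.rcVec-<ᵇ σⁿ narrow-injectiveOn (m<n⇒m<1+n a<k) (m<n⇒m<1+n b<k) ⟩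
        (val σⁿ (s + reflect (suc k) b) <ᵇ val σⁿ (s + reflect (suc k) a))
          ≡⟨ cong₂ (λ x y → val σⁿ x <ᵇ val σⁿ y) (shift b<k) (shift a<k) ⟩
        (val σⁿ (suc s + reflect k b) <ᵇ val σⁿ (suc s + reflect k a))
          ≡⟨ Narrow.rcVec-<ᵇ σ σ-injective (reflect-< b<k) (reflect-< a<k) ⟩
        (val σ (suc s + reflect k (reflect k a)) <ᵇ val σ (suc s + reflect k (reflect k b)))
          ≡⟨ cong₂ (λ x y → val σ (suc s + x) <ᵇ val σ (suc s + y)) (reflect-involutive a<k) (reflect-involutive b<k) ⟩
        (val σ (suc s + a) <ᵇ val σ (suc s + b))
          ∎
        where
        open ≡-Reasoning
        σⁿ : Vec (Fin n) n
        σⁿ = rcVec (suc s) k σ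
        shift : ∀ {c} → c < k → s + reflect (suc k) c ≡ suc s + reflect k c
        shift c<k = trans (cong (s +_) (reflect-suc c<k)) (+-suc s _)

      slideRight-injectiveOn : InjectiveOn n (val (slideRight σ))
      slideRight-injectiveOn = Narrow.rcVec-injectiveOn (rcVec s (suc k) σ) wide-injectiveOn

      slideLeft-injectiveOn : InjectiveOn n (val (slideLeft σ))
      slideLeft-injectiveOn = Wide.rcVec-injectiveOn (rcVec (suc s) k σ) narrow-injectiveOn

      inversionCount-slideRight : inversionCount n (val (slideRight σ)) ≡ inversionCount n (val σ)
      inversionCount-slideRight =
        trans (Narrow.inversionCount-rcVec (rcVec s (suc k) σ) wide-injectiveOn) (Wide.inversionCount-rcVec σ σ-injective)

      inversionCount-slideLeft : inversionCount n (val (slideLeft σ)) ≡ inversionCount n (val σ)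
      inversionCount-slideLeft =
        trans (Wide.inversionCount-rcVec (rcVec (suc s) k σ) narrow-injectiveOn) (Narrow.inversionCount-rcVec σ σ-injective)

      slideLeft∘slideRight : slideLeft (slideRight σ) ≡ σ
      slideLeft∘slideRight =
        trans (cong (rcVec {n} s (suc k)) (Narrow.rcVec-involutive (rcVec s (suc k) σ) wide-injectiveOn))
              (Wide.rcVec-involutive σ σ-injective)

      slideRight∘slideLeft : slideRight (slideLeft σ) ≡ σ
      slideRight∘slideLeft =
        trans (cong (rcVec {n} (suc s) k) (Wide.rcVec-involutive (rcVec (suc s) k σ) narrow-injectiveOn))
              (Narrow.rcVec-involutive σ σ-injective)

    slideRight-occurrence : ∀ {σ} → Occurrence s σ → Occurrence (suc s) (slideRight σ)
    slideRight-occurrence {σ} (occurrence σ-injective inv≡m pat) = occurrence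
      (slideRight-injectiveOn σ σ-injective)
      (trans (inversionCount-slideRight σ σ-injective) inv≡m)
      (λ a b → trans (pat a b) (sym (slideRight-<ᵇ σ σ-injective (Finₚ.toℕ<n a) (Finₚ.toℕ<n b))))

    slideLeft-occurrence : ∀ {σ} → Occurrence (suc s) σ → Occurrence s (slideLeft σ)
    slideLeft-occurrence {σ} (occurrence σ-injective inv≡m pat) = occurrence
      (slideLeft-injectiveOn σ σ-injective)
      (trans (inversionCount-slideLeft σ σ-injective) inv≡m)
      (λ a b → trans (pat a b) (sym (slideLeft-<ᵇ σ σ-injective (Finₚ.toℕ<n a) (Finₚ.toℕ<n b))))

    length-occurrences-slide : length (occurrences (suc s)) ≡ length (occurrences (suc (suc s)))
    length-occurrences-slide = bijection⇒length≡ slideRight slideLeft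
      (occurrences-unique (suc s)) (occurrences-unique (suc (suc s)))
      (λ {σ} σ∈ → Equivalence.from ∈-occurrences (slideRight-occurrence {σ} (Equivalence.to ∈-occurrences σ∈)))
      (λ {σ} σ∈ → Equivalence.from ∈-occurrences (slideLeft-occurrence {σ} (Equivalence.to ∈-occurrences σ∈)))
      (λ {σ} σ∈ → slideLeft∘slideRight σ (Occurrence.injective (Equivalence.to ∈-occurrences σ∈)))
      (λ {σ} σ∈ → slideRight∘slideLeft σ (Occurrence.injective (Equivalence.to ∈-occurrences σ∈)))

  length-occurrences : ∀ s → s + k ≤ n → length (occurrences (suc s)) ≡ length (occurrences 1)
  length-occurrences zero    _     = refl
  length-occurrences (suc s) s+k<n =
    trans (sym (Slide.length-occurrences-slide s+k<n)) (length-occurrences s (<⇒≤ s+k<n))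

position-bound : ∀ {n k s} → k ≤ n → suc s ≤ n + 1 ∸ k → s + k ≤ n
position-bound {n} {k} {s} k≤n 1+s≤n+1-k =
  m≤o∸n⇒m+n≤o s k≤n (s≤s⁻¹ (subst (suc s ≤_) (trans (+-∸-comm 1 k≤n) (+-comm (n ∸ k) 1)) 1+s≤n+1-k))

proposition8 : (n m k : ℕ) → 1 ≤ k → k ≤ n →
    .{{_ : NonZero (length (permsWithInv n m))}} →
    (τ : Vec (Fin k) k) → Injective _≡_ _≡_ (lookup τ) →
    (i j : ℕ) → 1 ≤ i → i ≤ n + 1 ∸ k → 1 ≤ j → j ≤ n + 1 ∸ k →
    prob n m τ i ≡ prob n m τ j
proposition8 n m k _ k≤n τ _ (suc s) (suc t) _ i≤ _ j≤ =
  cong (λ c → (ℤ.+ c) ℚ./ length (permsWithInv n m))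
    (trans (length-occurrences {n} {m} τ s (position-bound k≤n i≤))
           (sym (length-occurrences {n} {m} τ t (position-bound k≤n j≤))))
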